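{- Let $r \geq 3$ and $n \geq 0$ be integers. There exists a twin-free $K_r$-saturated graph on $n$ vertices if and only if none of the following holds: $n=r$; $n=r+1$; $r=3$ and $n=6$; $r=3$ and $n=7$.
   Context: All graphs are finite and simple. For a vertex $v$, $\Gamma(v)$ denotes its (open) neighbourhood. Two distinct vertices $v,w$ are twins if $\Gamma(v)=\Gamma(w)$; a graph is twin-free if it has no pair of twins. A graph $G$ is $K_r$-saturated if $G$ contains no copy of $K_r$ but adding any edge between two non-adjacent vertices of $G$ creates a copy of $K_r$. -}

module Defs where

open import Data.Nat using (ℕ)
open import Data.Fin using (Fin)
open import Data.Product using (Σ; _×_; ∃)
open import Data.Sum using (_⊎_)
open import Relation.Nullary using (¬_; Dec)
open import Relation.Binary.PropositionalEquality using (_≡_)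
open import Function.Bundles using (_⇔_)
open import Function.Definitions using (Injective)
open import Level using (0ℓ)

record Graph (n : ℕ) : Set₁ where
  field
    Adj    : Fin n → Fin n → Set
    adj?   : ∀ u v → Dec (Adj u v)
    sym    : ∀ {u v} → Adj u v → Adj v u
    irrefl : ∀ {u} → ¬ Adj u u

open Graph public

AdjPlus : ∀ {n} → Graph n → Fin n → Fin n → Fin n → Fin n → Set
AdjPlus G a b u v = Adj G u v ⊎ ((u ≡ a × v ≡ b) ⊎ (u ≡ b × v ≡ a))

ContainsK : ∀ {n} → ℕ → (Fin n → Fin n → Set) → Set
ContainsK {n} r E =
  Σ (Fin r → Fin n) λ f →
    Injective _≡_ _≡_ f × (∀ i j → ¬ i ≡ j → E (f i) (f j))

Saturated : ∀ {n} → ℕ → Graph n → Set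
Saturated r G =
  ¬ ContainsK r (Adj G) ×
  (∀ u v → ¬ u ≡ v → ¬ Adj G u v → ContainsK r (AdjPlus G u v))

Twins : ∀ {n} → Graph n → Fin n → Fin n → Set
Twins G v w = ¬ v ≡ w × (∀ u → Adj G v u ⇔ Adj G w u)

TwinFree : ∀ {n} → Graph n → Set
TwinFree G = ∀ v w → ¬ Twins G v w

{-# OPTIONS --safe #-}
-- For n < r the complete graph works.  If G is K_r-saturated and uv is a non-edge, the K_r of G + uv
-- contains u and v, and every other vertex on it is adjacent to both in G.  On r vertices that K_r is
-- everything, so u and v are twins; on r + 1 vertices it misses exactly one vertex, and comparing the K_r's
-- of G + uv and G + ut for a vertex t separating u from v shows that G - u is a K_r.
-- For r = 3 the graphs in question are the twin-free maximal triangle-free graphs.  There are such graphs on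
-- 5, 8 and 9 vertices and a family covering all n ≥ 10; on 6 or 7 vertices such a graph contains a pentagon
-- (a vertex has two adjacent non-neighbours, which close a 5-cycle through common neighbours), and an
-- exhaustive search over the adjacencies of the one or two remaining vertices finds no completion.
-- For r ≥ 4, a dominating vertex turns a graph for (r - 1, n - 1) into one for (r, n); only (4, 7) and
-- (4, 8) need separate examples.
module Submission where

open import Defs
open import Data.Bool using (Bool; true; false; T; _∨_)
open import Data.Bool.Properties using (T-∨)
open import Data.Empty using (⊥; ⊥-elim)
open import Data.Fin using (Fin; zero; suc; toℕ; punchIn; punchOut; _↑ʳ_; #_)
open import Data.Fin.Patterns using (0F; 1F; 2F; 3F; 4F)
open import Data.Fin.Properties
  using (_≟_; any?; injective⇒≤; <⇒notInjective; suc-injective; ↑ʳ-injective; punchOut-injective;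
         punchIn-injective; punchInᵢ≢i; punchIn-punchOut; +↔⊎; 1↔⊤)
open import Data.List using (List; []; _∷_)
open import Data.List.Membership.Propositional using (_∈_)
open import Data.List.Membership.DecPropositional using () renaming (_∈?_ to ∈?)
open import Data.Nat using (ℕ; zero; suc; _+_; _≤_; _<_; z≤n; s≤s)
open import Data.Nat.DivMod using (result; _divMod_)
open import Data.Nat.Properties
  using (1+n≰n; <⇒≱; <⇒≤; ≤-refl; _<?_; ≮⇒≥; m≤n⇒∃[o]m+o≡n; +-identityʳ; +-comm; +-cancelˡ-≤; +-monoʳ-≤;
         m≤m+n; m+1+n≰m)
open import Data.Nat.Solver using (module +-*-Solver)
open import Data.Product using (Σ; ∃; ∃₂; _×_; _,_; proj₁; proj₂)
import Data.Product as Product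
open import Data.Sum using (_⊎_; inj₁; inj₂; [_,_])
import Data.Sum as Sum
open import Data.Sum.Function.Propositional using (_⊎-↔_; _⊎-⇔_)
open import Data.Sum.Properties using () renaming (≡-dec to ≡-dec-⊎)
open import Data.Unit using (⊤; tt)
open import Data.Vec using (Vec; []; _∷_; lookup; tabulate)
open import Data.Vec.Functional using () renaming (_∷_ to _◂_)
open import Data.Vec.Properties using (lookup∘tabulate)
open import Function using (_∘_; id)
open import Function.Bundles using (_⇔_; mk⇔; Equivalence; _↔_; mk↔ₛ′; Inverse)
open import Function.Construct.Composition using (_↔-∘_; _⇔-∘_)
open import Function.Construct.Identity using (⇔-id; ↔-id)
open import Function.Construct.Symmetry using (⇔-sym)
open import Function.Definitions using (Injective)
open import Function.Properties.Inverse using (↔-sym)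
open import Level using (0ℓ)
open import Relation.Binary using (DecidableEquality)
import Relation.Binary.PropositionalEquality as ≡
open ≡ using (_≡_; _≢_; refl; cong; subst; subst₂)
open import Relation.Nullary using (¬_; Dec; does; yes; no; contradiction)
open import Relation.Nullary.Decidable as Dec
  using (¬?; _×-dec_; _⊎-dec_; _→-dec_; T?; map′; decidable-stable; True; toWitness)
open import Relation.Unary using (Pred; Decidable)

TwinFreeSaturatedGraph : ℕ → ℕ → Set₁
TwinFreeSaturatedGraph r n = Σ (Graph n) λ G → TwinFree G × Saturated r G

-- Finite search

Searchable : Set → Set₁
Searchable A = ∀ {P : Pred A 0ℓ} → Decidable P → Dec (∃ P)

∀? : ∀ {A} → Searchable A → ∀ {P : Pred A 0ℓ} → Decidable P → Dec (∀ x → P x)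
∀? search P? = map′ (λ ¬∃¬P x → decidable-stable (P? x) (λ ¬Px → ¬∃¬P (x , ¬Px)))
                    (λ ∀P (x , ¬Px) → ¬Px (∀P x))
                    (¬? (search (¬? ∘ P?)))

-- Unlike Data.Fin.Properties.any?, this reduces quickly enough to run the searches below during type checking.
searchable-Fin : ∀ n → Searchable (Fin n)
searchable-Fin zero    P? = no λ ()
searchable-Fin (suc n) P? =
  map′ [ (zero ,_) , (λ (i , p) → suc i , p) ]
       (λ { (zero , p) → inj₁ p ; (suc i , p) → inj₂ (i , p) })
       (P? zero ⊎-dec searchable-Fin n (P? ∘ suc))

searchable-Bool : Searchable Bool
searchable-Bool P? =
  map′ [ (true ,_) , (false ,_) ] (λ { (true , p) → inj₁ p ; (false , p) → inj₂ p })
       (P? true ⊎-dec P? false)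

searchable-⊎ : ∀ {A B} → Searchable A → Searchable B → Searchable (A ⊎ B)
searchable-⊎ searchA searchB P? =
  map′ [ (λ (x , p) → inj₁ x , p) , (λ (y , p) → inj₂ y , p) ]
       (λ { (inj₁ x , p) → inj₁ (x , p) ; (inj₂ y , p) → inj₂ (y , p) })
       (searchA (P? ∘ inj₁) ⊎-dec searchB (P? ∘ inj₂))

searchable-Vec : ∀ {A} → Searchable A → ∀ k → Searchable (Vec A k)
searchable-Vec search zero    P? = map′ ([] ,_) (λ { ([] , p) → p }) (P? [])
searchable-Vec search (suc k) P? =
  map′ (λ (x , xs , p) → x ∷ xs , p) (λ { (x ∷ xs , p) → x , xs , p })
       (search λ x → searchable-Vec search k λ xs → P? (x ∷ xs))

-- Injections between finite sets

injective-missing⇒≤ : ∀ {m n} {f : Fin m → Fin (suc n)} {w} →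
  Injective _≡_ _≡_ f → (∀ i → f i ≢ w) → m ≤ n
injective-missing⇒≤ f-inj miss =
  injective⇒≤ (λ eq → f-inj (punchOut-injective (miss _ ∘ ≡.sym) (miss _ ∘ ≡.sym) eq))

injective⇒surjective : ∀ {n} {f : Fin n → Fin n} → Injective _≡_ _≡_ f → ∀ w → ∃ λ i → f i ≡ w
injective⇒surjective {suc n} {f} f-inj w with any? (λ i → f i ≟ w)
... | yes hit = hit
... | no  miss = contradiction (injective-missing⇒≤ f-inj (λ i e → miss (i , e))) 1+n≰n

injective-misses-one : ∀ {n} {f : Fin n → Fin (suc n)} {x y} →
  Injective _≡_ _≡_ f → (∀ i → f i ≢ x) → y ≢ x → ∃ λ i → f i ≡ y
injective-misses-one {f = f} {x} f-inj miss y≢x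
  with i , eq ← injective⇒surjective {f = λ i → punchOut (miss i ∘ ≡.sym)}
                  (λ eq → f-inj (punchOut-injective (miss _ ∘ ≡.sym) (miss _ ∘ ≡.sym) eq))
                  (punchOut (y≢x ∘ ≡.sym))
  = i , punchOut-injective (miss i ∘ ≡.sym) (y≢x ∘ ≡.sym) eq

<⇒missing : ∀ {m n} (f : Fin m → Fin n) → m < n → ∃ λ w → ∀ i → f i ≢ w
<⇒missing {m} {n} f m<n with any? (λ w → ¬? (any? λ i → f i ≟ w))
... | yes (w , unhit) = w , λ i e → unhit (i , e)
... | no  allHit = contradiction (injective⇒≤ section-injective) (<⇒≱ m<n)
  where
  hit : ∀ w → ∃ λ i → f i ≡ w
  hit w = decidable-stable (any? λ i → f i ≟ w) (λ unhit → allHit (w , unhit))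
  section-injective : Injective _≡_ _≡_ (proj₁ ∘ hit)
  section-injective {w} {w′} eq = ≡.trans (≡.sym (proj₂ (hit w))) (≡.trans (cong f eq) (proj₂ (hit w′)))

◂-injective : ∀ {m n} {x : Fin n} {f : Fin m → Fin n} →
  (∀ i → f i ≢ x) → Injective _≡_ _≡_ f → Injective _≡_ _≡_ (x ◂ f)
◂-injective fresh f-inj {zero}  {zero}  _  = refl
◂-injective fresh f-inj {zero}  {suc j} eq = contradiction (≡.sym eq) (fresh j)
◂-injective fresh f-inj {suc i} {zero}  eq = contradiction eq (fresh i)
◂-injective fresh f-inj {suc i} {suc j} eq = cong suc (f-inj eq)

extend-injection : ∀ d {k n} (v : Fin k → Fin n) → Injective _≡_ _≡_ v → d + k ≤ n →
  ∃ λ (π : Fin (d + k) → Fin n) → Injective _≡_ _≡_ π × ∀ c → π (d ↑ʳ c) ≡ v c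
extend-injection zero    v v-inj _ = v , v-inj , λ _ → refl
extend-injection (suc d) v v-inj d+k<n
  with π , π-inj , π-v ← extend-injection d v v-inj (<⇒≤ d+k<n)
  with w , fresh ← <⇒missing π d+k<n
  = w ◂ π , ◂-injective fresh π-inj , π-v

injective⇒↔ : ∀ {n} {f : Fin n → Fin n} → Injective _≡_ _≡_ f → Fin n ↔ Fin n
injective⇒↔ {f = f} f-inj = mk↔ₛ′ f (proj₁ ∘ surj) (proj₂ ∘ surj) (λ i → f-inj (proj₂ (surj (f i))))
  where surj = injective⇒surjective f-inj

-- Cliques and added edges

IsClique : ∀ {n k} → (Fin n → Fin n → Set) → (Fin k → Fin n) → Set
IsClique E f = ∀ i j → i ≢ j → E (f i) (f j)

clique⇒injective : ∀ {n k} {E : Fin n → Fin n → Set} {f : Fin k → Fin n} →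
  (∀ {x} → ¬ E x x) → IsClique E f → Injective _≡_ _≡_ f
clique⇒injective {E = E} {f} irrefl′ f-cl {i} {j} fi≡fj with i ≟ j
... | yes i≡j = i≡j
... | no  i≢j = contradiction (subst (E (f i)) (≡.sym fi≡fj) (f-cl i j i≢j)) irrefl′

◂-clique : ∀ {n k} {E : Fin n → Fin n → Set} {x} {f : Fin k → Fin n} →
  (∀ {y z} → E y z → E z y) → (∀ i → E x (f i)) → IsClique E f → IsClique E (x ◂ f)
◂-clique sym′ x~f f-cl zero    zero    0≢0 = contradiction refl 0≢0
◂-clique sym′ x~f f-cl zero    (suc j) _   = x~f j
◂-clique sym′ x~f f-cl (suc i) zero    _   = sym′ (x~f i)
◂-clique sym′ x~f f-cl (suc i) (suc j) i≢j = f-cl i j (i≢j ∘ cong suc)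

module _ {n} (G : Graph n) where

  CliqueIn : Pred (Fin n) 0ℓ → ℕ → Set
  CliqueIn P k = Σ (Fin k → Fin n) λ f → IsClique (Adj G) f × ∀ i → P (f i)

  cliqueIn? : ∀ {P} → Decidable P → ∀ k → Dec (CliqueIn P k)
  cliqueIn? P? zero    = yes ((λ ()) , (λ ()) , (λ ()))
  cliqueIn? P? (suc k) =
    map′ (λ (x , Px , f , f-cl , Pf) →
            x ◂ f , ◂-clique {E = Adj G} (sym G) (proj₂ ∘ Pf) f-cl , λ { zero → Px ; (suc i) → proj₁ (Pf i) })
         (λ (f , f-cl , Pf) →
            f zero , Pf zero , f ∘ suc , (λ i j i≢j → f-cl (suc i) (suc j) (i≢j ∘ suc-injective)) ,
            λ i → Pf (suc i) , f-cl zero (suc i) λ ())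
         (searchable-Fin n λ x → P? x ×-dec cliqueIn? (λ y → P? y ×-dec adj? G x y) k)

  containsK? : ∀ k → Dec (ContainsK k (Adj G))
  containsK? k =
    map′ (λ (f , f-cl , _) → f , clique⇒injective {E = Adj G} (irrefl G) f-cl , f-cl)
         (λ (f , _ , f-cl) → f , f-cl , _)
         (cliqueIn? {λ _ → ⊤} (λ _ → yes tt) k)

CommonNeighbour : ∀ {n} → Graph n → Fin n → Fin n → Pred (Fin n) 0ℓ
CommonNeighbour G u v w = Adj G u w × Adj G v w

module _ {n} (G : Graph n) {u v : Fin n} where

  AdjPlus-sym : ∀ {x y} → AdjPlus G u v x y → AdjPlus G u v y x
  AdjPlus-sym (inj₁ xy)                   = inj₁ (sym G xy)
  AdjPlus-sym (inj₂ (inj₁ (x≡u , y≡v))) = inj₂ (inj₂ (y≡v , x≡u))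
  AdjPlus-sym (inj₂ (inj₂ (x≡v , y≡u))) = inj₂ (inj₁ (y≡u , x≡v))

  AdjPlus-swap : ∀ {x y} → AdjPlus G u v x y → AdjPlus G v u x y
  AdjPlus-swap (inj₁ xy)          = inj₁ xy
  AdjPlus-swap (inj₂ (inj₁ uv)) = inj₂ (inj₂ uv)
  AdjPlus-swap (inj₂ (inj₂ vu)) = inj₂ (inj₁ vu)

  AdjPlus-irrefl : u ≢ v → ∀ {x} → ¬ AdjPlus G u v x x
  AdjPlus-irrefl u≢v (inj₁ xx)                   = irrefl G xx
  AdjPlus-irrefl u≢v (inj₂ (inj₁ (refl , refl))) = u≢v refl
  AdjPlus-irrefl u≢v (inj₂ (inj₂ (refl , refl))) = u≢v refl

  AdjPlus⇒Adj : ∀ {x y} → ¬ (x ≡ u × y ≡ v) → ¬ (x ≡ v × y ≡ u) → AdjPlus G u v x y → Adj G x y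
  AdjPlus⇒Adj _   _   (inj₁ xy)          = xy
  AdjPlus⇒Adj ¬uv _   (inj₂ (inj₁ uv)) = contradiction uv ¬uv
  AdjPlus⇒Adj _   ¬vu (inj₂ (inj₂ vu)) = contradiction vu ¬vu

  common-clique⇒clique : ∀ {k} → u ≢ v → CliqueIn G (CommonNeighbour G u v) k → ContainsK (2 + k) (AdjPlus G u v)
  common-clique⇒clique u≢v (f , f-cl , common) =
    clique , clique⇒injective {E = AdjPlus G u v} (AdjPlus-irrefl u≢v) clique-cl , clique-cl
    where
    clique = u ◂ v ◂ f
    clique-cl : IsClique (AdjPlus G u v) clique
    clique-cl = ◂-clique {E = AdjPlus G u v} AdjPlus-sym
                  (λ { zero → inj₂ (inj₁ (refl , refl)) ; (suc i) → inj₁ (proj₁ (common i)) })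
                  (◂-clique {E = AdjPlus G u v} AdjPlus-sym (inj₁ ∘ proj₂ ∘ common) (λ i j → inj₁ ∘ f-cl i j))

  saturating-clique∋u : ∀ {r} → ¬ ContainsK r (Adj G) → ((f , _) : ContainsK r (AdjPlus G u v)) →
    ∃ λ i → f i ≡ u
  saturating-clique∋u K-free (f , f-inj , f-cl) with any? (λ i → f i ≟ u)
  ... | yes u∈f = u∈f
  ... | no  u∉f = ⊥-elim (K-free (f , f-inj , λ i j i≢j →
          AdjPlus⇒Adj (λ (fi≡u , _) → u∉f (i , fi≡u)) (λ (_ , fj≡u) → u∉f (j , fj≡u)) (f-cl i j i≢j)))

  saturating-clique-adj : ∀ {r} → ¬ ContainsK r (Adj G) → ((f , _) : ContainsK r (AdjPlus G u v)) →
    ∀ k → f k ≢ u → f k ≢ v → Adj G (f k) u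
  saturating-clique-adj K-free K@(f , _ , f-cl) k fk≢u fk≢v with i , fi≡u ← saturating-clique∋u K-free K =
    subst (Adj G (f k)) fi≡u (AdjPlus⇒Adj (fk≢u ∘ proj₁) (fk≢v ∘ proj₁) (f-cl k i λ { refl → fk≢u fi≡u }))

Separates : ∀ {V : Set} → (V → V → Set) → V → V → V → Set
Separates _~_ x y z = (x ~ z × ¬ y ~ z) ⊎ (¬ x ~ z × y ~ z)

module _ {n} (G : Graph n) where

  separating-vertex : TwinFree G → ∀ {x y} → x ≢ y → ∃ (Separates (Adj G) x y)
  separating-vertex twin-free {x} {y} x≢y
    with any? (λ z → (adj? G x z ×-dec ¬? (adj? G y z)) ⊎-dec (¬? (adj? G x z) ×-dec adj? G y z))
  ... | yes separator = separator
  ... | no  none = ⊥-elim (twin-free x y (x≢y , λ z → mk⇔ (to z) (from z)))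
    where
    to : ∀ z → Adj G x z → Adj G y z
    to z xz = decidable-stable (adj? G y z) λ y≁z → none (z , inj₁ (xz , y≁z))
    from : ∀ z → Adj G y z → Adj G x z
    from z yz = decidable-stable (adj? G x z) λ x≁z → none (z , inj₂ (x≁z , yz))

  nonadjacent-pair : ∀ {r} → ¬ ContainsK r (Adj G) → (g : Fin r → Fin n) → Injective _≡_ _≡_ g →
    ∃₂ λ x y → x ≢ y × ¬ Adj G x y
  nonadjacent-pair K-free g g-inj
    with any? (λ x → any? λ y → ¬? (x ≟ y) ×-dec ¬? (adj? G x y))
  ... | yes (x , y , found) = x , y , found
  ... | no  none = ⊥-elim (K-free (g , g-inj , λ i j i≢j → adjacent (g i) (g j) (i≢j ∘ g-inj)))
    where
    adjacent : ∀ x y → x ≢ y → Adj G x y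
    adjacent x y x≢y = decidable-stable (adj? G x y) λ x≁y → none (x , y , x≢y , x≁y)

  swap-clique : ∀ {r u v} → ContainsK r (AdjPlus G u v) → ContainsK r (AdjPlus G v u)
  swap-clique (f , f-inj , f-cl) = f , f-inj , λ i j → AdjPlus-swap G ∘ f-cl i j

-- Graphs on r and r + 1 vertices

no-twinFreeSaturated-on-r : ∀ {r} (G : Graph r) → TwinFree G → ¬ Saturated r G
no-twinFreeSaturated-on-r G twin-free (K-free , saturating)
  with u , v , u≢v , u≁v ← nonadjacent-pair G K-free id id
  = twin-free u v (u≢v , λ t → mk⇔ (to t) (from t))
  where
  K = saturating u v u≢v u≁v
  -- the K_r of G + uv covers every vertex
  neighbour-of-both : ∀ {t} → t ≢ u → t ≢ v → Adj G u t × Adj G v t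
  neighbour-of-both {t} t≢u t≢v with k , refl ← injective⇒surjective (proj₁ (proj₂ K)) t =
    sym G (saturating-clique-adj G K-free K k t≢u t≢v) ,
    sym G (saturating-clique-adj G K-free (swap-clique G K) k t≢v t≢u)
  to : ∀ t → Adj G u t → Adj G v t
  to t ut = proj₂ (neighbour-of-both (λ { refl → irrefl G ut }) (λ { refl → u≁v ut }))
  from : ∀ t → Adj G v t → Adj G u t
  from t vt = proj₁ (neighbour-of-both (λ { refl → u≁v (sym G vt) }) (λ { refl → irrefl G vt }))

clique-on-all-but-one : ∀ {r} {R : Fin (suc r) → Fin (suc r) → Set} {f : Fin r → Fin (suc r)} {w} →
  Injective _≡_ _≡_ f → IsClique R f → (∀ i → f i ≢ w) → ∀ x y → x ≢ w → y ≢ w → x ≢ y → R x y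
clique-on-all-but-one f-inj f-cl miss x y x≢w y≢w x≢y
  with i , refl ← injective-misses-one f-inj miss x≢w
  with j , refl ← injective-misses-one f-inj miss y≢w
  = f-cl i j λ { refl → x≢y refl }

-- G + uv has a K_r avoiding t and G + ut one avoiding v; together they make G - u complete.
all-but-u-clique : ∀ {r} (G : Graph (suc r)) → Saturated r G →
  ∀ u v t → u ≢ v → ¬ Adj G u v → ¬ Adj G u t → Adj G v t → ContainsK r (Adj G)
all-but-u-clique {r} G (K-free , saturating) u v t u≢v u≁v u≁t vt =
  punchIn u , punchIn-injective u _ _ , λ i j i≢j →
    off-u (punchIn u i) (punchIn u j) (punchInᵢ≢i u i) (punchInᵢ≢i u j) (i≢j ∘ punchIn-injective u i j)
  where
  t≢u : t ≢ u
  t≢u refl = u≁v (sym G vt)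
  t≢v : t ≢ v
  t≢v refl = irrefl G vt
  avoids : ∀ {a b w} ((f , _) : ContainsK r (AdjPlus G a b)) → ¬ Adj G w a → w ≢ a → w ≢ b → ∀ i → f i ≢ w
  avoids K w≁a w≢a w≢b i refl = w≁a (saturating-clique-adj G K-free K i w≢a w≢b)
  off-t : ∀ x y → x ≢ t → y ≢ t → x ≢ y → AdjPlus G u v x y
  off-t with K ← saturating u v u≢v u≁v =
    clique-on-all-but-one (proj₁ (proj₂ K)) (proj₂ (proj₂ K)) (avoids K (u≁t ∘ sym G) t≢u t≢v)
  off-v : ∀ x y → x ≢ v → y ≢ v → x ≢ y → AdjPlus G u t x y
  off-v with K ← saturating u t (t≢u ∘ ≡.sym) u≁t =
    clique-on-all-but-one (proj₁ (proj₂ K)) (proj₂ (proj₂ K)) (avoids K (u≁v ∘ sym G) (u≢v ∘ ≡.sym) (t≢v ∘ ≡.sym))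
  off-u : ∀ x y → x ≢ u → y ≢ u → x ≢ y → Adj G x y
  off-u x y x≢u y≢u x≢y with x ≟ t | y ≟ t
  ... | no x≢t | no y≢t = AdjPlus⇒Adj G (x≢u ∘ proj₁) (y≢u ∘ proj₂) (off-t x y x≢t y≢t x≢y)
  ... | yes refl | _ with y ≟ v
  ...   | yes refl = sym G vt
  ...   | no  y≢v  = AdjPlus⇒Adj G (x≢u ∘ proj₁) (y≢u ∘ proj₂) (off-v x y t≢v y≢v x≢y)
  off-u x y x≢u y≢u x≢y | no x≢t | yes refl with x ≟ v
  ...   | yes refl = vt
  ...   | no  x≢v  = AdjPlus⇒Adj G (x≢u ∘ proj₁) (y≢u ∘ proj₂) (off-v x y x≢v t≢v x≢y)

no-twinFreeSaturated-on-r+1 : ∀ {r} (G : Graph (suc r)) → TwinFree G → ¬ Saturated r G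
no-twinFreeSaturated-on-r+1 G twin-free saturated@(K-free , _)
  with u , v , u≢v , u≁v ← nonadjacent-pair G K-free suc suc-injective
  with separating-vertex G twin-free u≢v
... | t , inj₁ (ut , v≁t) = K-free (all-but-u-clique G saturated v u t (u≢v ∘ ≡.sym) (u≁v ∘ sym G) v≁t ut)
... | t , inj₂ (u≁t , vt) = K-free (all-but-u-clique G saturated u v t u≢v u≁v u≁t vt)

-- Maximal triangle-free relations

record TwinFreeMaximalTriangleFree {V : Set} (_~_ : V → V → Set) : Set where
  field
    _~?_             : ∀ x y → Dec (x ~ y)
    ~-sym            : ∀ {x y} → x ~ y → y ~ x
    ~-irrefl         : ∀ {x} → ¬ x ~ x
    triangle-free    : ∀ {x y z} → ¬ (x ~ y × y ~ z × x ~ z)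
    common-neighbour : ∀ {x y} → x ≢ y → ¬ x ~ y → ∃ λ z → x ~ z × y ~ z
    separated        : ∀ {x y} → x ≢ y → ∃ (Separates _~_ x y)

module _ {n} (G : Graph n) where

  triangle⇒K₃ : ∀ {x y z} → Adj G x y → Adj G y z → Adj G x z → ContainsK 3 (Adj G)
  triangle⇒K₃ {x} {y} {z} xy yz xz = triangle , clique⇒injective {E = Adj G} (irrefl G) triangle-cl , triangle-cl
    where
    triangle = x ◂ y ◂ z ◂ λ ()
    triangle-cl : IsClique (Adj G) triangle
    triangle-cl = ◂-clique {E = Adj G} (sym G) (λ { 0F → xy ; 1F → xz ; (suc (suc ())) })
                    (◂-clique {E = Adj G} (sym G) (λ { 0F → yz ; (suc ()) }) (◂-clique {E = Adj G} (sym G) (λ ()) (λ ())))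

  saturated⇒maximal-triangle-free : TwinFree G → Saturated 3 G → TwinFreeMaximalTriangleFree (Adj G)
  saturated⇒maximal-triangle-free twin-free (K₃-free , saturating) = record
    { _~?_             = adj? G
    ; ~-sym            = sym G
    ; ~-irrefl         = irrefl G
    ; triangle-free    = λ (xy , yz , xz) → K₃-free (triangle⇒K₃ xy yz xz)
    ; common-neighbour = common-neighbour
    ; separated        = separating-vertex G twin-free
    }
    where
    common-neighbour : ∀ {x y} → x ≢ y → ¬ Adj G x y → ∃ λ z → Adj G x z × Adj G y z
    -- the K₃ of G + xy consists of x, y and a common neighbour
    common-neighbour x≢y x≁y
      with K@(f , f-inj , _) ← saturating _ _ x≢y x≁y
      with i , refl ← saturating-clique∋u G K₃-free K
      with j , refl ← saturating-clique∋u G K₃-free (swap-clique G K)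
      with k , k∉ij ← <⇒missing (i ◂ j ◂ λ ()) (s≤s (s≤s (s≤s z≤n)))
      = let fk≢fi = k∉ij 0F ∘ ≡.sym ∘ f-inj
            fk≢fj = k∉ij 1F ∘ ≡.sym ∘ f-inj
        in f k , sym G (saturating-clique-adj G K₃-free K k fk≢fi fk≢fj)
               , sym G (saturating-clique-adj G K₃-free (swap-clique G K) k fk≢fj fk≢fi)

maximal-triangle-free⇒saturated : ∀ {n} {_~_ : Fin n → Fin n → Set} →
  TwinFreeMaximalTriangleFree _~_ → TwinFreeSaturatedGraph 3 n
maximal-triangle-free⇒saturated {_~_ = _~_} M = G , twin-free , K₃-free , saturating
  where
  open TwinFreeMaximalTriangleFree M
  G = record { Adj = _~_ ; adj? = _~?_ ; sym = ~-sym ; irrefl = ~-irrefl }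
  twin-free : TwinFree G
  twin-free x y (x≢y , same) with separated x≢y
  ... | z , inj₁ (xz , y≁z) = y≁z (Equivalence.to (same z) xz)
  ... | z , inj₂ (x≁z , yz) = x≁z (Equivalence.from (same z) yz)
  K₃-free : ¬ ContainsK 3 _~_
  K₃-free (_ , _ , f-cl) = triangle-free (f-cl 0F 1F (λ ()) , f-cl 1F 2F (λ ()) , f-cl 0F 2F (λ ()))
  saturating : ∀ x y → x ≢ y → ¬ x ~ y → ContainsK 3 (AdjPlus G x y)
  saturating x y x≢y x≁y with z , xz , yz ← common-neighbour x≢y x≁y =
    common-clique⇒clique G x≢y ((z ◂ λ ()) , ◂-clique {E = _~_} ~-sym (λ ()) (λ ()) , λ { 0F → xz , yz ; (suc ()) })

module _ {V W : Set} {_~_ : V → V → Set} {_≈_ : W → W → Set}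
         (σ : W ↔ V) (≈⇔~ : ∀ x y → x ≈ y ⇔ Inverse.to σ x ~ Inverse.to σ y) where

  open Inverse σ
  open Equivalence using () renaming (to to ⇒; from to ⇐)

  transport : TwinFreeMaximalTriangleFree _~_ → TwinFreeMaximalTriangleFree _≈_
  transport M = record
    { _~?_             = λ x y → Dec.map (⇔-sym (≈⇔~ x y)) (to x ~? to y)
    ; ~-sym            = ⇐ (≈⇔~ _ _) ∘ ~-sym ∘ ⇒ (≈⇔~ _ _)
    ; ~-irrefl         = ~-irrefl ∘ ⇒ (≈⇔~ _ _)
    ; triangle-free    = λ (xy , yz , xz) → triangle-free (⇒ (≈⇔~ _ _) xy , ⇒ (≈⇔~ _ _) yz , ⇒ (≈⇔~ _ _) xz)
    ; common-neighbour = λ {x} {y} x≢y x≁y →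
        let z , xz , yz = common-neighbour (x≢y ∘ to-injective) (x≁y ∘ ⇐ (≈⇔~ x y))
        in from z , ⇐ (adj-from x z) xz , ⇐ (adj-from y z) yz
    ; separated        = λ {x} {y} x≢y → let z , s = separated (x≢y ∘ to-injective) in from z , separates x y z s
    }
    where
    open TwinFreeMaximalTriangleFree M
    to-injective : ∀ {x y} → to x ≡ to y → x ≡ y
    to-injective {x} {y} eq = ≡.trans (≡.sym (strictlyInverseʳ x)) (≡.trans (cong from eq) (strictlyInverseʳ y))
    adj-from : ∀ x z → x ≈ from z ⇔ to x ~ z
    adj-from x z = subst (λ w → x ≈ from z ⇔ to x ~ w) (strictlyInverseˡ z) (≈⇔~ x (from z))
    separates : ∀ x y z → Separates _~_ (to x) (to y) z → Separates _≈_ x y (from z)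
    separates x y z (inj₁ (xz , y≁z)) = inj₁ (⇐ (adj-from x z) xz , y≁z ∘ ⇒ (adj-from y z))
    separates x y z (inj₂ (x≁z , yz)) = inj₂ (x≁z ∘ ⇒ (adj-from x z) , ⇐ (adj-from y z) yz)

module _ {V : Set} (search : Searchable V) (_≟ᵥ_ : DecidableEquality V) where

  maximal-triangle-free? : ∀ {_~_ : V → V → Set} → (∀ x y → Dec (x ~ y)) → Dec (TwinFreeMaximalTriangleFree _~_)
  -- The conditions are tested in an order that makes the exhaustive searches below fail fast.
  maximal-triangle-free? {_~_} _~?_ =
    map′ (λ (irrefl′ , sym′ , common , sep , tri) → record
            { _~?_ = _~?_ ; ~-sym = sym′ _ _ ; ~-irrefl = irrefl′ _ ; triangle-free = tri _ _ _
            ; common-neighbour = common _ _ ; separated = sep _ _ })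
         (λ M → let open TwinFreeMaximalTriangleFree M in
            (λ _ → ~-irrefl) , (λ _ _ → ~-sym) , (λ _ _ → common-neighbour) , (λ _ _ → separated) ,
            (λ _ _ _ → triangle-free))
         ((∀V? λ x → ¬? (x ~? x)) ×-dec
          (∀V? λ x → ∀V? λ y → x ~? y →-dec y ~? x) ×-dec
          (∀V? λ x → ∀V? λ y → ¬? (x ≟ᵥ y) →-dec ¬? (x ~? y) →-dec search λ z → x ~? z ×-dec y ~? z) ×-dec
          (∀V? λ x → ∀V? λ y → ¬? (x ≟ᵥ y) →-dec
             search λ z → (x ~? z ×-dec ¬? (y ~? z)) ⊎-dec (¬? (x ~? z) ×-dec y ~? z)) ×-dec
          (∀V? λ x → ∀V? λ y → ∀V? λ z → ¬? (x ~? y ×-dec y ~? z ×-dec x ~? z)))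
    where ∀V? = ∀? search

-- Constructions

complete : ∀ n → Graph n
complete n = record { Adj = _≢_ ; adj? = λ x y → ¬? (x ≟ y) ; sym = _∘ ≡.sym ; irrefl = λ x≢x → x≢x refl }

complete-twinFreeSaturated : ∀ {r n} → n < r → TwinFreeSaturatedGraph r n
complete-twinFreeSaturated n<r = complete _ , twin-free , K-free , λ x y x≢y x≁y → contradiction x≢y x≁y
  where
  twin-free : TwinFree (complete _)
  twin-free x y (x≢y , same) = Equivalence.from (same x) (x≢y ∘ ≡.sym) refl
  K-free : ¬ ContainsK _ (Adj (complete _))
  K-free (_ , f-inj , _) = <⇒notInjective n<r f-inj

module _ {n} (G : Graph n) where

  ConeAdj : Fin (suc n) → Fin (suc n) → Set
  ConeAdj zero    zero    = ⊥
  ConeAdj zero    (suc _) = ⊤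
  ConeAdj (suc _) zero    = ⊤
  ConeAdj (suc x) (suc y) = Adj G x y

  cone : Graph (suc n)
  cone = record { Adj = ConeAdj ; adj? = adj?′ ; sym = λ {x} {y} → sym′ x y ; irrefl = λ {x} → irrefl′ x }
    where
    adj?′ : ∀ x y → Dec (ConeAdj x y)
    adj?′ zero    zero    = no id
    adj?′ zero    (suc _) = yes tt
    adj?′ (suc _) zero    = yes tt
    adj?′ (suc x) (suc y) = adj? G x y
    sym′ : ∀ x y → ConeAdj x y → ConeAdj y x
    sym′ zero    (suc _) _  = tt
    sym′ (suc _) zero    _  = tt
    sym′ (suc x) (suc y) xy = sym G xy
    irrefl′ : ∀ x → ¬ ConeAdj x x
    irrefl′ (suc x) = irrefl G

  cone-twinFree : TwinFree G → TwinFree cone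
  cone-twinFree twin-free zero    zero    (0≢0 , _)    = 0≢0 refl
  cone-twinFree twin-free zero    (suc y) (_ , same)   = irrefl G (Equivalence.to (same (suc y)) tt)
  cone-twinFree twin-free (suc x) zero    (_ , same)   = irrefl G (Equivalence.from (same (suc x)) tt)
  cone-twinFree twin-free (suc x) (suc y) (x≢y , same) = twin-free x y (x≢y ∘ cong suc , same ∘ suc)

  cone-K-free : ∀ {r} → ¬ ContainsK r (Adj G) → ¬ ContainsK (suc r) ConeAdj
  cone-K-free K-free (f , f-inj , f-cl) =
    K-free (g , clique⇒injective {E = Adj G} (irrefl G) g-cl , g-cl)
    where
    -- drop the apex from the clique, or an arbitrary vertex if the apex is not on it
    drop : ∃ λ i₀ → ∀ j → f (punchIn i₀ j) ≢ zero
    drop with any? (λ i → f i ≟ zero)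
    ... | yes (i₀ , fi₀≡0) = i₀ , λ j e → punchInᵢ≢i i₀ j (f-inj (≡.trans e (≡.sym fi₀≡0)))
    ... | no  apex∉f       = zero , λ j e → apex∉f (_ , e)
    i₀ = proj₁ drop
    g : Fin _ → Fin n
    g j = punchOut (proj₂ drop j ∘ ≡.sym)
    f≡suc-g : ∀ j → f (punchIn i₀ j) ≡ suc (g j)
    f≡suc-g j = ≡.sym (punchIn-punchOut (proj₂ drop j ∘ ≡.sym))
    g-cl : IsClique (Adj G) g
    g-cl i j i≢j = subst₂ ConeAdj (f≡suc-g i) (f≡suc-g j)
                     (f-cl (punchIn i₀ i) (punchIn i₀ j) (i≢j ∘ punchIn-injective i₀ i j))

  cone-saturating : ∀ {r} → (∀ x y → x ≢ y → ¬ Adj G x y → ContainsK r (AdjPlus G x y)) →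
    ∀ x y → x ≢ y → ¬ ConeAdj x y → ContainsK (suc r) (AdjPlus cone x y)
  cone-saturating saturating zero    zero    0≢0 _   = contradiction refl 0≢0
  cone-saturating saturating zero    (suc y) _   0≁y = contradiction tt 0≁y
  cone-saturating saturating (suc x) zero    _   x≁0 = contradiction tt x≁0
  cone-saturating saturating (suc x) (suc y) x≢y x≁y
    with f , _ , f-cl ← saturating x y (x≢y ∘ cong suc) x≁y =
    clique , clique⇒injective {E = AdjPlus cone (suc x) (suc y)} (AdjPlus-irrefl cone x≢y) clique-cl , clique-cl
    where
    clique = zero ◂ suc ∘ f
    lift-edge : ∀ {a b} → AdjPlus G x y a b → AdjPlus cone (suc x) (suc y) (suc a) (suc b)
    lift-edge = Sum.map id (Sum.map (Product.map (cong suc) (cong suc)) (Product.map (cong suc) (cong suc)))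
    clique-cl : IsClique (AdjPlus cone (suc x) (suc y)) clique
    clique-cl = ◂-clique {E = AdjPlus cone (suc x) (suc y)} (AdjPlus-sym cone) (λ _ → inj₁ tt)
                  λ i j → lift-edge ∘ f-cl i j

cone-twinFreeSaturated : ∀ {r n} → TwinFreeSaturatedGraph r n → TwinFreeSaturatedGraph (suc r) (suc n)
cone-twinFreeSaturated (G , twin-free , K-free , saturating) =
  cone G , cone-twinFree G twin-free , cone-K-free G K-free , cone-saturating G saturating

graph : ∀ n → Vec (List (Fin n)) n → Graph n
graph n N = record
  { Adj    = λ x y → x ≢ y × (y ∈ lookup N x ⊎ x ∈ lookup N y)
  ; adj?   = λ x y → ¬? (x ≟ y) ×-dec (∈? _≟_ y (lookup N x) ⊎-dec ∈? _≟_ x (lookup N y))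
  ; sym    = λ (x≢y , e) → x≢y ∘ ≡.sym , Sum.swap e
  ; irrefl = λ (x≢x , _) → x≢x refl
  }

_⇔?_ : ∀ {A B : Set} → Dec A → Dec B → Dec (A ⇔ B)
A? ⇔? B? = map′ (λ (f , g) → mk⇔ f g) (λ A⇔B → Equivalence.to A⇔B , Equivalence.from A⇔B)
                ((A? →-dec B?) ×-dec (B? →-dec A?))

module _ {n} (G : Graph n) where

  twinFree? : Dec (TwinFree G)
  twinFree? = ∀? (searchable-Fin n) λ x → ∀? (searchable-Fin n) λ y →
    ¬? (¬? (x ≟ y) ×-dec ∀? (searchable-Fin n) λ z → adj? G x z ⇔? adj? G y z)

  Certificate : ℕ → Set
  Certificate k = TwinFree G × ¬ ContainsK (2 + k) (Adj G) ×
                  ∀ x y → x ≢ y → ¬ Adj G x y → CliqueIn G (CommonNeighbour G x y) k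

  certificate? : ∀ k → Dec (Certificate k)
  certificate? k = twinFree? ×-dec ¬? (containsK? G (2 + k)) ×-dec
    ∀? (searchable-Fin n) λ x → ∀? (searchable-Fin n) λ y → ¬? (x ≟ y) →-dec ¬? (adj? G x y) →-dec
      cliqueIn? G (λ z → adj? G x z ×-dec adj? G y z) k

  certified : ∀ k → True (certificate? k) → TwinFreeSaturatedGraph (2 + k) n
  certified k certificate with twin-free , K-free , common ← toWitness certificate =
    G , twin-free , K-free , λ x y x≢y x≁y → common-clique⇒clique G x≢y (common x y x≢y x≁y)

C₅ : Graph 5
C₅ = graph 5 ((# 1 ∷ # 4 ∷ []) ∷ (# 2 ∷ []) ∷ (# 3 ∷ []) ∷ (# 4 ∷ []) ∷ [] ∷ [])

Wagner : Graph 8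
Wagner = graph 8 ((# 1 ∷ # 4 ∷ # 7 ∷ []) ∷ (# 2 ∷ # 5 ∷ []) ∷ (# 3 ∷ # 6 ∷ []) ∷ (# 4 ∷ # 7 ∷ []) ∷
                  (# 5 ∷ []) ∷ (# 6 ∷ []) ∷ (# 7 ∷ []) ∷ [] ∷ [])

G₉ : Graph 9
G₉ = graph 9 ((# 3 ∷ # 4 ∷ # 7 ∷ []) ∷ (# 2 ∷ # 5 ∷ # 7 ∷ []) ∷ (# 4 ∷ # 8 ∷ []) ∷ (# 5 ∷ # 8 ∷ []) ∷
                (# 6 ∷ []) ∷ (# 6 ∷ []) ∷ (# 7 ∷ # 8 ∷ []) ∷ [] ∷ [] ∷ [])

C₇-complement : Graph 7
C₇-complement = graph 7 ((# 2 ∷ # 3 ∷ # 4 ∷ # 5 ∷ []) ∷ (# 3 ∷ # 4 ∷ # 5 ∷ # 6 ∷ []) ∷ (# 4 ∷ # 5 ∷ # 6 ∷ []) ∷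
                         (# 5 ∷ # 6 ∷ []) ∷ (# 6 ∷ []) ∷ [] ∷ [] ∷ [])

H₈ : Graph 8
H₈ = graph 8 ((# 2 ∷ # 4 ∷ # 5 ∷ # 7 ∷ []) ∷ (# 2 ∷ # 3 ∷ # 4 ∷ # 6 ∷ # 7 ∷ []) ∷ (# 3 ∷ # 4 ∷ # 5 ∷ []) ∷
                (# 5 ∷ # 6 ∷ []) ∷ (# 6 ∷ []) ∷ (# 6 ∷ # 7 ∷ []) ∷ (# 7 ∷ []) ∷ [] ∷ [])

twinFreeSaturated-3-5 : TwinFreeSaturatedGraph 3 5
twinFreeSaturated-3-5 = certified C₅ 1 tt

twinFreeSaturated-3-8 : TwinFreeSaturatedGraph 3 8
twinFreeSaturated-3-8 = certified Wagner 1 tt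

twinFreeSaturated-3-9 : TwinFreeSaturatedGraph 3 9
twinFreeSaturated-3-9 = certified G₉ 1 tt

twinFreeSaturated-4-7 : TwinFreeSaturatedGraph 4 7
twinFreeSaturated-4-7 = certified C₇-complement 2 tt

twinFreeSaturated-4-8 : TwinFreeSaturatedGraph 4 8
twinFreeSaturated-4-8 = certified H₈ 2 tt

Extend : ∀ {V : Set} → (V → V → Set) → (V → Set) → ⊤ ⊎ V → ⊤ ⊎ V → Set
Extend _~_ S (inj₁ _) (inj₁ _) = ⊥
Extend _~_ S (inj₁ _) (inj₂ y) = S y
Extend _~_ S (inj₂ x) (inj₁ _) = S x
Extend _~_ S (inj₂ x) (inj₂ y) = x ~ y

add-vertex : ∀ {N} {W : Set} → Fin N ↔ W → Fin (suc N) ↔ (⊤ ⊎ W)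
add-vertex τ = (1↔⊤ ⊎-↔ τ) ↔-∘ +↔⊎

module _ {V : Set} {_~_ : V → V → Set} (M : TwinFreeMaximalTriangleFree _~_)
         {S : V → Set} (S? : Decidable S)
         (independent : ∀ {x y} → S x → S y → ¬ x ~ y)
         (dominating : ∀ x → ¬ S x → ∃ λ s → S s × x ~ s)
         (not-a-neighbourhood : ∀ x → ∃ λ z → (x ~ z × ¬ S z) ⊎ (¬ x ~ z × S z)) where

  open TwinFreeMaximalTriangleFree M

  extension : TwinFreeMaximalTriangleFree (Extend _~_ S)
  extension = record
    { _~?_             = dec
    ; ~-sym            = λ {x} {y} → sym′ x y
    ; ~-irrefl         = λ {x} → irrefl′ x
    ; triangle-free    = λ {x} {y} {z} → triangle-free′ x y z
    ; common-neighbour = λ {x} {y} → common-neighbour′ x y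
    ; separated        = λ {x} {y} → separated′ x y
    }
    where
    _~⁺_ = Extend _~_ S
    dec : ∀ x y → Dec (x ~⁺ y)
    dec (inj₁ _) (inj₁ _) = no id
    dec (inj₁ _) (inj₂ y) = S? y
    dec (inj₂ x) (inj₁ _) = S? x
    dec (inj₂ x) (inj₂ y) = x ~? y
    sym′ : ∀ x y → x ~⁺ y → y ~⁺ x
    sym′ (inj₁ _) (inj₂ _) Sy = Sy
    sym′ (inj₂ _) (inj₁ _) Sx = Sx
    sym′ (inj₂ _) (inj₂ _) xy = ~-sym xy
    irrefl′ : ∀ x → ¬ x ~⁺ x
    irrefl′ (inj₂ _) = ~-irrefl
    triangle-free′ : ∀ x y z → ¬ (x ~⁺ y × y ~⁺ z × x ~⁺ z)
    triangle-free′ (inj₁ _) (inj₂ _) (inj₂ _) (Sy , yz , Sz) = independent Sy Sz yz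
    triangle-free′ (inj₂ _) (inj₁ _) (inj₂ _) (Sx , Sz , xz) = independent Sx Sz xz
    triangle-free′ (inj₂ _) (inj₂ _) (inj₁ _) (xy , Sy , Sx) = independent Sx Sy xy
    triangle-free′ (inj₂ _) (inj₂ _) (inj₂ _) xyz            = triangle-free xyz
    common-neighbour′ : ∀ x y → x ≢ y → ¬ x ~⁺ y → ∃ λ z → x ~⁺ z × y ~⁺ z
    common-neighbour′ (inj₁ _) (inj₁ _) x≢y _ = contradiction refl x≢y
    common-neighbour′ (inj₁ _) (inj₂ y) _ ¬Sy with s , Ss , ys ← dominating y ¬Sy = inj₂ s , Ss , ys
    common-neighbour′ (inj₂ x) (inj₁ _) _ ¬Sx with s , Ss , xs ← dominating x ¬Sx = inj₂ s , xs , Ss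
    common-neighbour′ (inj₂ x) (inj₂ y) x≢y x≁y with z , xz , yz ← common-neighbour (x≢y ∘ cong inj₂) x≁y =
      inj₂ z , xz , yz
    separated′ : ∀ x y → x ≢ y → ∃ (Separates _~⁺_ x y)
    separated′ (inj₁ _) (inj₁ _) x≢y = contradiction refl x≢y
    separated′ (inj₁ _) (inj₂ y) _ with not-a-neighbourhood y
    ... | z , inj₁ (yz , ¬Sz) = inj₂ z , inj₂ (¬Sz , yz)
    ... | z , inj₂ (y≁z , Sz) = inj₂ z , inj₁ (Sz , y≁z)
    separated′ (inj₂ x) (inj₁ _) _ with z , sep ← not-a-neighbourhood x = inj₂ z , sep
    separated′ (inj₂ x) (inj₂ y) x≢y with z , sep ← separated (x≢y ∘ cong inj₂) = inj₂ z , sep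

-- A graph on the 3K + 1 vertices aᵢ, bᵢ, cᵢ (i < K) and h, K ≥ 3.  Adding a vertex joined to h and all aᵢ,
-- then one joined to h and all bᵢ, gives 3K + 2 and 3K + 3 vertices, so every n ≥ 10 is covered.
module Family (q : ℕ) where

  K : ℕ
  K = 3 + q

  Vertex : Set
  Vertex = Fin K ⊎ Fin K ⊎ Fin K ⊎ ⊤

  pattern a i = inj₁ i
  pattern b i = inj₂ (inj₁ i)
  pattern c i = inj₂ (inj₂ (inj₁ i))
  pattern h   = inj₂ (inj₂ (inj₂ tt))

  third : ∀ (i j : Fin K) → ∃ λ l → l ≢ i × l ≢ j
  third i j with l , fresh ← <⇒missing (i ◂ j ◂ λ ()) (s≤s (s≤s (s≤s z≤n))) =
    l , fresh zero ∘ ≡.sym , fresh (suc zero) ∘ ≡.sym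

  _~_ : Vertex → Vertex → Set
  a i ~ b j = i ≢ j
  b j ~ a i = i ≢ j
  a i ~ c j = i ≡ j
  c j ~ a i = i ≡ j
  b i ~ c j = i ≡ j
  c j ~ b i = i ≡ j
  c _ ~ h   = ⊤
  h   ~ c _ = ⊤
  _   ~ _   = ⊥

  M₀ : TwinFreeMaximalTriangleFree _~_
  M₀ = record
    { _~?_             = dec
    ; ~-sym            = λ {x} {y} → sym′ x y
    ; ~-irrefl         = λ {x} → irrefl′ x
    ; triangle-free    = λ {x} {y} {z} → triangle-free′ x y z
    ; common-neighbour = λ {x} {y} → common-neighbour′ x y
    ; separated        = λ {x} {y} → separated′ x y
    }
    where
    dec : ∀ x y → Dec (x ~ y)
    dec (a i) (b j) = ¬? (i ≟ j)
    dec (b j) (a i) = ¬? (i ≟ j)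
    dec (a i) (c j) = i ≟ j
    dec (c j) (a i) = i ≟ j
    dec (b i) (c j) = i ≟ j
    dec (c j) (b i) = i ≟ j
    dec (c _) h     = yes tt
    dec h     (c _) = yes tt
    dec (a _) (a _) = no id
    dec (a _) h     = no id
    dec (b _) (b _) = no id
    dec (b _) h     = no id
    dec (c _) (c _) = no id
    dec h     (a _) = no id
    dec h     (b _) = no id
    dec h     h     = no id
    sym′ : ∀ x y → x ~ y → y ~ x
    sym′ (a _) (b _) p = p
    sym′ (b _) (a _) p = p
    sym′ (a _) (c _) p = p
    sym′ (c _) (a _) p = p
    sym′ (b _) (c _) p = p
    sym′ (c _) (b _) p = p
    sym′ (c _) h     p = p
    sym′ h     (c _) p = p
    irrefl′ : ∀ x → ¬ x ~ x
    irrefl′ (a _) ()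
    irrefl′ (b _) ()
    irrefl′ (c _) ()
    irrefl′ h     ()
    triangle-free′ : ∀ x y z → ¬ (x ~ y × y ~ z × x ~ z)
    triangle-free′ (a i) (b j) (c k) (i≢j , refl , refl) = i≢j refl
    triangle-free′ (a i) (c j) (b k) (refl , refl , i≢k) = i≢k refl
    triangle-free′ (b i) (a j) (c k) (j≢i , refl , refl) = j≢i refl
    triangle-free′ (b i) (c j) (a k) (refl , refl , k≢i) = k≢i refl
    triangle-free′ (c i) (a j) (b k) (refl , j≢k , refl) = j≢k refl
    triangle-free′ (c i) (b j) (a k) (refl , k≢j , refl) = k≢j refl
    triangle-free′ (a _) (c _) (c _) (_ , () , _)
    triangle-free′ (a _) (c _) h     (_ , _ , ())
    triangle-free′ (b _) (c _) (b _) (_ , _ , ())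
    triangle-free′ (b _) (c _) (c _) (_ , () , _)
    triangle-free′ (b _) (c _) h     (_ , _ , ())
    triangle-free′ (c _) (a _) (c _) (_ , _ , ())
    triangle-free′ (c _) (a _) h     (_ , () , _)
    triangle-free′ (c _) (b _) (b _) (_ , () , _)
    triangle-free′ (c _) (b _) (c _) (_ , _ , ())
    triangle-free′ (c _) (b _) h     (_ , () , _)
    triangle-free′ (c _) h     (a _) (_ , () , _)
    triangle-free′ (c _) h     (b _) (_ , () , _)
    triangle-free′ (c _) h     (c _) (_ , _ , ())
    triangle-free′ (c _) h     h     (_ , () , _)
    triangle-free′ h     (c _) (a _) (_ , _ , ())
    triangle-free′ h     (c _) (b _) (_ , _ , ())
    triangle-free′ h     (c _) (c _) (_ , () , _)
    triangle-free′ h     (c _) h     (_ , _ , ())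
    common-neighbour′ : ∀ x y → x ≢ y → ¬ x ~ y → ∃ λ z → x ~ z × y ~ z
    common-neighbour′ (a i) (a j) _ _ with l , l≢i , l≢j ← third i j = b l , l≢i ∘ ≡.sym , l≢j ∘ ≡.sym
    common-neighbour′ (b i) (b j) _ _ with l , l≢i , l≢j ← third i j = a l , l≢i , l≢j
    common-neighbour′ (a i) (b j) _ ¬i≢j = c i , refl , ≡.sym (decidable-stable (i ≟ j) ¬i≢j)
    common-neighbour′ (b j) (a i) _ ¬i≢j = c i , ≡.sym (decidable-stable (i ≟ j) ¬i≢j) , refl
    common-neighbour′ (a i) (c j) _ i≢j = b j , i≢j , refl
    common-neighbour′ (c j) (a i) _ i≢j = b j , refl , i≢j
    common-neighbour′ (b i) (c j) _ i≢j = a j , i≢j ∘ ≡.sym , refl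
    common-neighbour′ (c j) (b i) _ i≢j = a j , refl , i≢j ∘ ≡.sym
    common-neighbour′ (c i) (c j) _ _ = h , tt , tt
    common-neighbour′ (a i) h _ _ = c i , refl , tt
    common-neighbour′ h (a i) _ _ = c i , tt , refl
    common-neighbour′ (b i) h _ _ = c i , refl , tt
    common-neighbour′ h (b i) _ _ = c i , tt , refl
    common-neighbour′ (c _) h _ c≁h = contradiction tt c≁h
    common-neighbour′ h (c _) _ h≁c = contradiction tt h≁c
    common-neighbour′ h h h≢h _ = contradiction refl h≢h
    separated′ : ∀ x y → x ≢ y → ∃ (Separates _~_ x y)
    separated′ (a i) (a j) ai≢aj = c i , inj₁ (refl , ai≢aj ∘ cong a ∘ ≡.sym)
    separated′ (b i) (b j) bi≢bj = c i , inj₁ (refl , bi≢bj ∘ cong b ∘ ≡.sym)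
    separated′ (c i) (c j) ci≢cj = a i , inj₁ (refl , ci≢cj ∘ cong c)
    separated′ (a i) (b j) _ with l , l≢i , _ ← third i i = b l , inj₁ (l≢i ∘ ≡.sym , id)
    separated′ (b j) (a i) _ with l , l≢i , _ ← third i i = b l , inj₂ (id , l≢i ∘ ≡.sym)
    separated′ (a i) (c j) _ with l , l≢i , l≢j ← third i j = b l , inj₁ (l≢i ∘ ≡.sym , l≢j)
    separated′ (c j) (a i) _ with l , l≢i , l≢j ← third i j = b l , inj₂ (l≢j , l≢i ∘ ≡.sym)
    separated′ (b i) (c j) _ with l , l≢i , l≢j ← third i j = a l , inj₁ (l≢i , l≢j)
    separated′ (c j) (b i) _ with l , l≢i , l≢j ← third i j = a l , inj₂ (l≢j , l≢i)
    separated′ (a i) h _ with l , l≢i , _ ← third i i = b l , inj₁ (l≢i ∘ ≡.sym , id)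
    separated′ h (a i) _ with l , l≢i , _ ← third i i = b l , inj₂ (id , l≢i ∘ ≡.sym)
    separated′ (b i) h _ with l , l≢i , _ ← third i i = a l , inj₁ (l≢i , id)
    separated′ h (b i) _ with l , l≢i , _ ← third i i = a l , inj₂ (id , l≢i)
    separated′ (c _) h _ = h , inj₁ (tt , id)
    separated′ h (c _) _ = h , inj₂ (id , tt)
    separated′ h h h≢h = contradiction refl h≢h


  InA : Vertex → Set
  InA (a _) = ⊤
  InA h     = ⊤
  InA _     = ⊥

  InA? : Decidable InA
  InA? (a _) = yes tt
  InA? (b _) = no id
  InA? (c _) = no id
  InA? h     = yes tt

  pattern new   = inj₁ tt
  pattern old x = inj₂ x

  _~₁_ : ⊤ ⊎ Vertex → ⊤ ⊎ Vertex → Set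
  _~₁_ = Extend _~_ InA

  M₁ : TwinFreeMaximalTriangleFree _~₁_
  M₁ = extension M₀ InA? independent dominating not-a-neighbourhood
    where
    independent : ∀ {x y} → InA x → InA y → ¬ x ~ y
    independent {a _} {a _} _ _ ()
    independent {a _} {h}   _ _ ()
    independent {h}   {a _} _ _ ()
    independent {h}   {h}   _ _ ()
    dominating : ∀ x → ¬ InA x → ∃ λ s → InA s × x ~ s
    dominating (a _) ¬A = contradiction tt ¬A
    dominating (b j) _ with l , l≢j , _ ← third j j = a l , tt , l≢j
    dominating (c _) _ = h , tt , tt
    dominating h ¬A = contradiction tt ¬A
    not-a-neighbourhood : ∀ x → ∃ λ z → (x ~ z × ¬ InA z) ⊎ (¬ x ~ z × InA z)
    not-a-neighbourhood (a _) = h , inj₂ (id , tt)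
    not-a-neighbourhood (b _) = h , inj₂ (id , tt)
    not-a-neighbourhood (c j) with l , l≢j , _ ← third j j = a l , inj₂ (l≢j , tt)
    not-a-neighbourhood h     = h , inj₂ (id , tt)

  InB : ⊤ ⊎ Vertex → Set
  InB (old (b _)) = ⊤
  InB (old h)     = ⊤
  InB _           = ⊥

  InB? : Decidable InB
  InB? new         = no id
  InB? (old (a _)) = no id
  InB? (old (b _)) = yes tt
  InB? (old (c _)) = no id
  InB? (old h)     = yes tt

  M₂ : TwinFreeMaximalTriangleFree (Extend _~₁_ InB)
  M₂ = extension M₁ InB? independent dominating not-a-neighbourhood
    where
    independent : ∀ {x y} → InB x → InB y → ¬ x ~₁ y
    independent {old (b _)} {old (b _)} _ _ ()
    independent {old (b _)} {old h}     _ _ ()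
    independent {old h}     {old (b _)} _ _ ()
    independent {old h}     {old h}     _ _ ()
    dominating : ∀ x → ¬ InB x → ∃ λ s → InB s × x ~₁ s
    dominating new         _ = old h , tt , tt
    dominating (old (a i)) _ with l , l≢i , _ ← third i i = old (b l) , tt , l≢i ∘ ≡.sym
    dominating (old (b _)) ¬B = contradiction tt ¬B
    dominating (old (c _)) _ = old h , tt , tt
    dominating (old h)     ¬B = contradiction tt ¬B
    not-a-neighbourhood : ∀ x → ∃ λ z → (x ~₁ z × ¬ InB z) ⊎ (¬ x ~₁ z × InB z)
    not-a-neighbourhood new         = old (b zero) , inj₂ (id , tt)
    not-a-neighbourhood (old (a _)) = old h , inj₂ (id , tt)
    not-a-neighbourhood (old (b _)) = old h , inj₂ (id , tt)
    not-a-neighbourhood (old (c i)) with l , l≢i , _ ← third i i = old (b l) , inj₂ (l≢i , tt)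
    not-a-neighbourhood (old h)     = old h , inj₂ (id , tt)

  size : ℕ
  size = K + (K + (K + 1))

  σ : Fin size ↔ Vertex
  σ = (↔-id _ ⊎-↔ ((↔-id _ ⊎-↔ ((↔-id _ ⊎-↔ 1↔⊤) ↔-∘ +↔⊎)) ↔-∘ +↔⊎)) ↔-∘ +↔⊎

family : ∀ q (e : Fin 3) → TwinFreeSaturatedGraph 3 (toℕ e + Family.size q)
family q zero = maximal-triangle-free⇒saturated (transport σ (λ _ _ → ⇔-id _) M₀)
  where open Family q
family q (suc zero) = maximal-triangle-free⇒saturated (transport (add-vertex σ) (λ _ _ → ⇔-id _) M₁)
  where open Family q
family q (suc (suc zero)) = maximal-triangle-free⇒saturated (transport (add-vertex (add-vertex σ)) (λ _ _ → ⇔-id _) M₂)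
  where open Family q

-- Pentagons

next : Fin 5 → Fin 5
next 0F = 1F
next 1F = 2F
next 2F = 3F
next 3F = 4F
next 4F = 0F

next⁵ : ∀ i → next (next (next (next (next i)))) ≡ i
next⁵ 0F = refl
next⁵ 1F = refl
next⁵ 2F = refl
next⁵ 3F = refl
next⁵ 4F = refl

Adjacent₅ : Fin 5 → Fin 5 → Set
Adjacent₅ i j = j ≡ next i ⊎ i ≡ next j

pentagon-pairs : ∀ i j → i ≡ j ⊎ Adjacent₅ i j ⊎ j ≡ next (next i) ⊎ i ≡ next (next j)
pentagon-pairs = toWitness {a? = ∀? (searchable-Fin 5) λ i → ∀? (searchable-Fin 5) λ j →
  i ≟ j ⊎-dec (j ≟ next i ⊎-dec i ≟ next j) ⊎-dec j ≟ next (next i) ⊎-dec i ≟ next (next j)} tt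

Pentagon : ∀ {V : Set} → (V → V → Set) → Set
Pentagon {V} _~_ = Σ (Fin 5 → V) λ v → ∀ i → v i ~ v (next i)

module _ {V : Set} {_~_ : V → V → Set} (M : TwinFreeMaximalTriangleFree _~_) where

  open TwinFreeMaximalTriangleFree M

  pentagon-through : ∀ {a p q} → a ≢ p → ¬ a ~ p → a ≢ q → ¬ a ~ q → p ~ q → Pentagon _~_
  pentagon-through {a} {p} {q} a≢p a≁p a≢q a≁q pq
    with z₁ , az₁ , pz₁ ← common-neighbour a≢p a≁p
    with z₂ , az₂ , qz₂ ← common-neighbour a≢q a≁q
    = (a ◂ z₁ ◂ p ◂ q ◂ z₂ ◂ λ ()) , λ { 0F → az₁ ; 1F → ~-sym pz₁ ; 2F → pq ; 3F → qz₂ ; 4F → ~-sym az₂ }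

  adjacent-non-neighbours : ∀ {a p} → a ≢ p → ¬ a ~ p →
    ∃₂ λ p′ q → a ≢ p′ × ¬ a ~ p′ × a ≢ q × ¬ a ~ q × p′ ~ q
  adjacent-non-neighbours {a} {p} a≢p a≁p with separated a≢p
  ... | z , inj₂ (a≁z , pz) = p , z , a≢p , a≁p , (λ { refl → a≁p (~-sym pz) }) , a≁z , pz
  ... | z , inj₁ (az , p≁z) with w , pw , zw ← common-neighbour (λ { refl → a≁p az }) p≁z =
    p , w , a≢p , a≁p , (λ { refl → a≁p (~-sym pw) }) , (λ aw → triangle-free (az , zw , aw)) , pw

  universal-vertex-impossible : ∀ {a b c} → (∀ x → a ≢ x → a ~ x) → a ≢ b → a ≢ c → b ≢ c → ⊥
  universal-vertex-impossible {a} {b} {c} a~ a≢b a≢c b≢c with separated b≢c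
  ... | z , inj₁ (bz , c≁z) = triangle-free (a~ b a≢b , bz , a~ z λ { refl → c≁z (~-sym (a~ c a≢c)) })
  ... | z , inj₂ (b≁z , cz) = triangle-free (a~ c a≢c , cz , a~ z λ { refl → b≁z (~-sym (a~ b a≢b)) })

  find-pentagon : Searchable V → DecidableEquality V → ∀ {a b c : V} → a ≢ b → a ≢ c → b ≢ c → Pentagon _~_
  find-pentagon search _≟ᵥ_ {a} a≢b a≢c b≢c with search (λ p → ¬? (a ≟ᵥ p) ×-dec ¬? (a ~? p))
  ... | yes (p , a≢p , a≁p) with _ , _ , a≢p′ , a≁p′ , a≢q , a≁q , p′q ← adjacent-non-neighbours a≢p a≁p =
    pentagon-through a≢p′ a≁p′ a≢q a≁q p′q
  ... | no none = ⊥-elim (universal-vertex-impossible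
          (λ x a≢x → decidable-stable (a ~? x) λ a≁x → none (x , a≢x , a≁x)) a≢b a≢c b≢c)

  no-short-return : ((v , _) : Pentagon _~_) → ∀ i → v (next (next i)) ≢ v i
  no-short-return (v , edge) i eq = triangle-free (edge (next (next i)) , edge (next (next (next i))) ,
    ~-sym (subst (v (next (next (next (next i)))) ~_) (≡.trans (cong v (next⁵ i)) (≡.sym eq))
                 (edge (next (next (next (next i)))))))

  pentagon-injective : ((v , _) : Pentagon _~_) → ∀ {i j} → v i ≡ v j → i ≡ j
  pentagon-injective P@(v , edge) {i} {j} eq with pentagon-pairs i j
  ... | inj₁ i≡j = i≡j
  ... | inj₂ (inj₁ (inj₁ refl)) = contradiction (subst (v i ~_) (≡.sym eq) (edge i)) ~-irrefl
  ... | inj₂ (inj₁ (inj₂ refl)) = contradiction (subst (v j ~_) eq (edge j)) ~-irrefl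
  ... | inj₂ (inj₂ (inj₁ refl)) = contradiction (≡.sym eq) (no-short-return P i)
  ... | inj₂ (inj₂ (inj₂ refl)) = contradiction eq (no-short-return P j)

  pentagon-adjacency : ((v , _) : Pentagon _~_) → ∀ i j → v i ~ v j ⇔ Adjacent₅ i j
  pentagon-adjacency (v , edge) i j = mk⇔ classify λ { (inj₁ refl) → edge i ; (inj₂ refl) → ~-sym (edge j) }
    where
    classify : v i ~ v j → Adjacent₅ i j
    classify vij with pentagon-pairs i j
    ... | inj₁ refl = contradiction vij ~-irrefl
    ... | inj₂ (inj₁ adjacent) = adjacent
    ... | inj₂ (inj₂ (inj₁ refl)) = ⊥-elim (triangle-free (edge i , edge (next i) , vij))
    ... | inj₂ (inj₂ (inj₂ refl)) = ⊥-elim (triangle-free (edge j , edge (next j) , ~-sym vij))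

cycle₅ : Fin 5 → Fin 5 → Bool
cycle₅ i j = does (j ≟ next i) ∨ does (i ≟ next j)

-- inner: adjacency among the d new vertices, rows: their adjacency to the pentagon
pentagon-extension : ∀ {d} → Vec (Vec Bool d) d → Vec (Vec Bool 5) d → Fin d ⊎ Fin 5 → Fin d ⊎ Fin 5 → Bool
pentagon-extension inner rows (inj₁ a) (inj₁ b) = lookup (lookup inner a) b
pentagon-extension inner rows (inj₁ a) (inj₂ j) = lookup (lookup rows a) j
pentagon-extension inner rows (inj₂ i) (inj₁ b) = lookup (lookup rows b) i
pentagon-extension inner rows (inj₂ i) (inj₂ j) = cycle₅ i j

IndependentOnPentagon : Vec Bool 5 → Set
IndependentOnPentagon row = ∀ i → ¬ (T (lookup row i) × T (lookup row (next i)))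

NoPentagonExtension : ℕ → Set
NoPentagonExtension d = ∀ (rows : Vec (Vec Bool 5) d) → (∀ a → IndependentOnPentagon (lookup rows a)) →
  ∀ inner → ¬ TwinFreeMaximalTriangleFree (λ x y → T (pentagon-extension inner rows x y))

noPentagonExtension? : ∀ d → Dec (NoPentagonExtension d)
noPentagonExtension? d =
  ∀? (searchable-Vec (searchable-Vec searchable-Bool 5) d) λ rows →
    (∀? (searchable-Fin d) λ a → ∀? (searchable-Fin 5) λ i →
       ¬? (T? (lookup (lookup rows a) i) ×-dec T? (lookup (lookup rows a) (next i)))) →-dec
    ∀? (searchable-Vec (searchable-Vec searchable-Bool d) d) λ inner →
      ¬? (maximal-triangle-free? (searchable-⊎ (searchable-Fin d) (searchable-Fin 5)) (≡-dec-⊎ _≟_ _≟_)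
            λ x y → T? (pentagon-extension inner rows x y))

no-pentagon-extension-by-1 : NoPentagonExtension 1
no-pentagon-extension-by-1 = toWitness {a? = noPentagonExtension? 1} tt

no-pentagon-extension-by-2 : NoPentagonExtension 2
no-pentagon-extension-by-2 = toWitness {a? = noPentagonExtension? 2} tt

T-does : ∀ {P : Set} (P? : Dec P) → T (does P?) ⇔ P
T-does (yes p)  = mk⇔ (λ _ → p) (λ _ → tt)
T-does (no  ¬p) = mk⇔ (λ ()) ¬p

truth-table : ∀ {m n} {P : Fin m → Fin n → Set} → (∀ a b → Dec (P a b)) → Vec (Vec Bool n) m
truth-table P? = tabulate λ a → tabulate λ b → does (P? a b)

truth-table⇔ : ∀ {m n} {P : Fin m → Fin n → Set} (P? : ∀ a b → Dec (P a b)) a b →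
  T (lookup (lookup (truth-table P?) a) b) ⇔ P a b
truth-table⇔ P? a b
  rewrite lookup∘tabulate (λ a → tabulate λ b → does (P? a b)) a | lookup∘tabulate (λ b → does (P? a b)) b
  = T-does (P? a b)

module _ (d : ℕ) {_~_ : Fin (d + 5) → Fin (d + 5) → Set} (M : TwinFreeMaximalTriangleFree _~_) where

  open TwinFreeMaximalTriangleFree M

  -- After relabelling so that the pentagon occupies the last five vertices, the relation is one of the
  -- finitely many tables excluded by NoPentagonExtension d.
  no-pentagon : NoPentagonExtension d → ¬ Pentagon _~_
  no-pentagon no-extension P@(v , edge)
    with π , π-inj , π-v ← extend-injection d v (pentagon-injective M P) ≤-refl =
    no-extension rows independent inner (transport σ table⇔ M)
    where
    σ : (Fin d ⊎ Fin 5) ↔ Fin (d + 5)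
    σ = injective⇒↔ π-inj ↔-∘ ↔-sym +↔⊎
    open Inverse σ using (to)
    new : Fin d → Fin (d + 5)
    new a = to (inj₁ a)
    inner = truth-table λ a b → new a ~? new b
    rows  = truth-table λ a i → new a ~? v i
    row⇔ : ∀ a i → T (lookup (lookup rows a) i) ⇔ new a ~ v i
    row⇔ = truth-table⇔ λ a i → new a ~? v i
    independent : ∀ a → IndependentOnPentagon (lookup rows a)
    independent a i (ai , ai+1) =
      triangle-free (Equivalence.to (row⇔ a i) ai , edge i , Equivalence.to (row⇔ a (next i)) ai+1)
    vertex : Fin d ⊎ Fin 5 → Fin (d + 5)
    vertex = [ new , v ]
    vertex≡to : ∀ x → vertex x ≡ to x
    vertex≡to (inj₁ a) = refl
    vertex≡to (inj₂ i) = ≡.sym (π-v i)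
    table⇔vertex : ∀ x y → T (pentagon-extension inner rows x y) ⇔ vertex x ~ vertex y
    table⇔vertex (inj₁ a) (inj₁ b) = truth-table⇔ (λ a b → new a ~? new b) a b
    table⇔vertex (inj₁ a) (inj₂ j) = row⇔ a j
    table⇔vertex (inj₂ i) (inj₁ b) = mk⇔ (~-sym ∘ Equivalence.to (row⇔ b i)) (Equivalence.from (row⇔ b i) ∘ ~-sym)
    table⇔vertex (inj₂ i) (inj₂ j) =
      ⇔-sym (pentagon-adjacency M P i j) ⇔-∘ ((T-does (j ≟ next i) ⊎-⇔ T-does (i ≟ next j)) ⇔-∘ T-∨)
    table⇔ : ∀ x y → T (pentagon-extension inner rows x y) ⇔ to x ~ to y
    table⇔ x y = ≡.subst₂ (λ w z → T (pentagon-extension inner rows x y) ⇔ w ~ z) (vertex≡to x) (vertex≡to y)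
                   (table⇔vertex x y)

no-twinFreeSaturated-3-on-d+5 : ∀ d → NoPentagonExtension d → ¬ TwinFreeSaturatedGraph 3 (d + 5)
no-twinFreeSaturated-3-on-d+5 d no-extension (G , twin-free , saturated) =
  no-pentagon d M no-extension
    (find-pentagon M (searchable-Fin (d + 5)) _≟_ {d ↑ʳ 0F} {d ↑ʳ 1F} {d ↑ʳ 2F}
       ((λ ()) ∘ ↑ʳ-injective d 0F 1F) ((λ ()) ∘ ↑ʳ-injective d 0F 2F) ((λ ()) ∘ ↑ʳ-injective d 1F 2F))
  where M = saturated⇒maximal-triangle-free G twin-free saturated

Exceptional : ℕ → ℕ → Set
Exceptional r n = n ≡ r ⊎ n ≡ r + 1 ⊎ (r ≡ 3 × n ≡ 6) ⊎ (r ≡ 3 × n ≡ 7)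

exceptional⇒nonexistent : ∀ {r n} → Exceptional r n → ¬ TwinFreeSaturatedGraph r n
exceptional⇒nonexistent (inj₁ refl) (G , twin-free , saturated) =
  no-twinFreeSaturated-on-r G twin-free saturated
exceptional⇒nonexistent {r} (inj₂ (inj₁ refl)) rewrite +-comm r 1 =
  λ (G , twin-free , saturated) → no-twinFreeSaturated-on-r+1 G twin-free saturated
exceptional⇒nonexistent (inj₂ (inj₂ (inj₁ (refl , refl)))) =
  no-twinFreeSaturated-3-on-d+5 1 no-pentagon-extension-by-1
exceptional⇒nonexistent (inj₂ (inj₂ (inj₂ (refl , refl)))) =
  no-twinFreeSaturated-3-on-d+5 2 no-pentagon-extension-by-2

not-exceptional : ∀ {r n} → r + 2 ≤ n → ¬ (r ≡ 3 × (n ≡ 6 ⊎ n ≡ 7)) → ¬ Exceptional r n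
not-exceptional {r} r+2≤n _ (inj₁ refl) = m+1+n≰m r r+2≤n
not-exceptional {r} r+2≤n _ (inj₂ (inj₁ refl)) with s≤s () ← +-cancelˡ-≤ r 2 1 r+2≤n
not-exceptional _ small (inj₂ (inj₂ (inj₁ (r≡3 , n≡6)))) = small (r≡3 , inj₁ n≡6)
not-exceptional _ small (inj₂ (inj₂ (inj₂ (r≡3 , n≡7)))) = small (r≡3 , inj₂ n≡7)

twinFreeSaturated-3-≥10 : ∀ j → TwinFreeSaturatedGraph 3 (10 + j)
twinFreeSaturated-3-≥10 j with result q e j≡e+3q ← j divMod 3 =
  subst (TwinFreeSaturatedGraph 3) size≡ (family q e)
  where
  open +-*-Solver
  size≡ : toℕ e + Family.size q ≡ 10 + j
  size≡ = ≡.trans (solve 2 (λ e q → e :+ ((con 3 :+ q) :+ ((con 3 :+ q) :+ ((con 3 :+ q) :+ con 1)))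
                                   := con 10 :+ (e :+ q :* con 3)) refl (toℕ e) q)
                  (≡.cong (10 +_) (≡.sym j≡e+3q))

construction-3 : ∀ n → ¬ Exceptional 3 n → TwinFreeSaturatedGraph 3 n
construction-3 0 _ = complete-twinFreeSaturated (s≤s z≤n)
construction-3 1 _ = complete-twinFreeSaturated (s≤s (s≤s z≤n))
construction-3 2 _ = complete-twinFreeSaturated (s≤s (s≤s (s≤s z≤n)))
construction-3 3 ¬exceptional = ⊥-elim (¬exceptional (inj₁ refl))
construction-3 4 ¬exceptional = ⊥-elim (¬exceptional (inj₂ (inj₁ refl)))
construction-3 5 _ = twinFreeSaturated-3-5
construction-3 6 ¬exceptional = ⊥-elim (¬exceptional (inj₂ (inj₂ (inj₁ (refl , refl)))))
construction-3 7 ¬exceptional = ⊥-elim (¬exceptional (inj₂ (inj₂ (inj₂ (refl , refl)))))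
construction-3 8 _ = twinFreeSaturated-3-8
construction-3 9 _ = twinFreeSaturated-3-9
construction-3 (suc (suc (suc (suc (suc (suc (suc (suc (suc (suc j)))))))))) _ = twinFreeSaturated-3-≥10 j

-- For r ≥ 4 and n ≥ r + 2, cone over a graph for (r - 1, n - 1), except for (4, 7) and (4, 8).
construction-step : ∀ m o → (∀ n → ¬ Exceptional (3 + m) n → TwinFreeSaturatedGraph (3 + m) n) →
  ¬ Exceptional (4 + m) (4 + m + o) → TwinFreeSaturatedGraph (4 + m) (4 + m + o)
construction-step m 0 _ ¬exceptional = ⊥-elim (¬exceptional (inj₁ (+-identityʳ (4 + m))))
construction-step m 1 _ ¬exceptional = ⊥-elim (¬exceptional (inj₂ (inj₁ refl)))
construction-step 0 3 _ _ = twinFreeSaturated-4-7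
construction-step 0 4 _ _ = twinFreeSaturated-4-8
construction-step 0 2 smaller _ =
  cone-twinFreeSaturated (smaller 5 (not-exceptional ≤-refl λ { (_ , inj₁ ()) ; (_ , inj₂ ()) }))
construction-step 0 (suc (suc (suc (suc (suc d))))) smaller _ =
  cone-twinFreeSaturated (smaller (8 + d) (not-exceptional (+-monoʳ-≤ 3 (m≤m+n 2 (3 + d)))
                                                          λ { (_ , inj₁ ()) ; (_ , inj₂ ()) }))
construction-step (suc m) (suc (suc d)) smaller _ =
  cone-twinFreeSaturated (smaller _ (not-exceptional (+-monoʳ-≤ (4 + m) (m≤m+n 2 d)) λ { (() , _) }))

construction : ∀ m n → ¬ Exceptional (3 + m) n → TwinFreeSaturatedGraph (3 + m) n
construction zero    n = construction-3 n
construction (suc m) n ¬exceptional with n <? 4 + m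
... | yes n<r = complete-twinFreeSaturated n<r
... | no  n≮r with o , refl ← m≤n⇒∃[o]m+o≡n (≮⇒≥ n≮r) =
  construction-step m o (construction m) ¬exceptional

theorem1 : (r n : ℕ) → 3 ≤ r →
    (Σ (Graph n) λ G → TwinFree G × Saturated r G)
      ⇔ (¬ (n ≡ r ⊎ n ≡ r + 1 ⊎ (r ≡ 3 × n ≡ 6) ⊎ (r ≡ 3 × n ≡ 7)))
theorem1 r n 3≤r with m , refl ← m≤n⇒∃[o]m+o≡n 3≤r =
  mk⇔ (λ G exceptional → exceptional⇒nonexistent exceptional G) (construction m n)
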